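{- Let $R$ be an EPRF-TRS over a ranked alphabet $\Sigma$ and let $p,q\in T_\Sigma(X)$. Then it is decidable whether there exists a term $r\in T_\Sigma(X)$ such that $p\Rightarrow^*_R r$ and $q\Rightarrow^*_R r$.
   Context: A ranked alphabet $\Sigma$ is a finite set of symbols with ranks; $X=\{x_1,x_2,\dots\}$ is a countable set of variables, $T_\Sigma(X)$ the terms over $\Sigma$ and $X$, $T_\Sigma$ the ground terms. A TRS $R$ over $\Sigma$ is a finite set of rules $l\to r$, $l,r\in T_\Sigma(X)$, with every variable of $r$ occurring in $l$; $\Rightarrow_R$ is the rewrite relation, $\Rightarrow^*_R$ its reflexive transitive closure; $sign(R)$ is the set of symbols occurring in the rules. For $L\subseteq T_\Sigma$, $R^*_\Sigma(L)=\{p\mid q\Rightarrow^*_R p,\ q\in L\}$. A bottom-up tree automaton (bta) over $\Sigma$ is a finite automaton with states $A$ (treated as constants), final states $A_f$, rules $\delta(a_1,\dots,a_n)\to a$ and $a\to a'$; it recognizes the ground terms rewriting to a final state. $R$ is an EPRF-TRS if for any given ranked alphabet $\Sigma\supseteq sign(R)$ and finite $L\subseteq T_\Sigma$ one can effectively construct a bta $\mathcal{C}$ over $\Sigma$ with $L(\mathcal{C})=R^*_\Sigma(L)$. -}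

module Defs where

open import Data.Nat using (ℕ; suc)
open import Data.Fin using (Fin)
open import Data.Product using (Σ; Σ-syntax; ∃; ∃-syntax; _×_; proj₂)
open import Data.Sum using (_⊎_; inj₁; inj₂)
open import Data.List using (List; []; _∷_; _++_)
open import Data.List.Membership.Propositional using (_∈_)
open import Data.List.Relation.Unary.All using (All)
open import Data.Vec using (Vec; []; _∷_; lookup; _[_]≔_)
open import Relation.Binary.PropositionalEquality using (_≡_)
open import Relation.Binary.Construct.Closure.ReflexiveTransitive using (Star)

-- A (global) symbol is a pair (name , rank).  A ranked alphabet Σ is a
-- finite set of symbols, represented as a list.

Sym : Set
Sym = ℕ × ℕ

rank : Sym → ℕ
rank = proj₂

RankedAlphabet : Set
RankedAlphabet = List Sym

_⊆Σ_ : List Sym → RankedAlphabet → Set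
S ⊆Σ Σ' = All (_∈ Σ') S

-- Terms with leaves ("variables") drawn from V.
-- Term ℕ : terms over the variable set X = {x₀, x₁, …}.

data Term (V : Set) : Set where
  var  : V → Term V
  node : (f : Sym) → Vec (Term V) (rank f) → Term V

mutual
  syms : ∀ {V} → Term V → List Sym
  syms (var _)     = []
  syms (node f ts) = f ∷ symsV ts

  symsV : ∀ {V n} → Vec (Term V) n → List Sym
  symsV []       = []
  symsV (t ∷ ts) = syms t ++ symsV ts

mutual
  vars : ∀ {V} → Term V → List V
  vars (var x)     = x ∷ []
  vars (node f ts) = varsV ts

  varsV : ∀ {V n} → Vec (Term V) n → List V
  varsV []       = []
  varsV (t ∷ ts) = vars t ++ varsV ts

mutual
  _⟪_⟫ : ∀ {V W} → Term V → (V → Term W) → Term W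
  var x     ⟪ σ ⟫ = σ x
  node f ts ⟪ σ ⟫ = node f (substV ts σ)

  substV : ∀ {V W n} → Vec (Term V) n → (V → Term W) → Vec (Term W) n
  substV []       σ = []
  substV (t ∷ ts) σ = (t ⟪ σ ⟫) ∷ substV ts σ

rename : ∀ {V W} → (V → W) → Term V → Term W
rename ρ t = t ⟪ (λ x → var (ρ x)) ⟫

InTΣX : RankedAlphabet → Term ℕ → Set
InTΣX Σ' t = syms t ⊆Σ Σ'

InTΣ : RankedAlphabet → Term ℕ → Set
InTΣ Σ' t = InTΣX Σ' t × vars t ≡ []

record Rule : Set where
  constructor _⟶_
  field
    lhs : Term ℕ
    rhs : Term ℕ

WellFormedRule : Rule → Set
WellFormedRule (l ⟶ r) = ∀ x → x ∈ vars r → x ∈ vars l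

record TRS : Set where
  field
    rules : List Rule
    wf    : All WellFormedRule rules
open TRS public

sign : TRS → List Sym
sign R = signRules (rules R)
  where
  signRules : List Rule → List Sym
  signRules []             = []
  signRules ((l ⟶ r) ∷ rs) = syms l ++ syms r ++ signRules rs

data _⊢_⇒_ (R : TRS) : Term ℕ → Term ℕ → Set where
  root : ∀ {l r} (σ : ℕ → Term ℕ) → (l ⟶ r) ∈ rules R →
         R ⊢ (l ⟪ σ ⟫) ⇒ (r ⟪ σ ⟫)
  cong : ∀ {f} (ts : Vec (Term ℕ) (rank f)) (i : Fin (rank f)) {t'} →
         R ⊢ lookup ts i ⇒ t' →
         R ⊢ node f ts ⇒ node f (ts [ i ]≔ t')

_⊢_⇒*_ : TRS → Term ℕ → Term ℕ → Set
R ⊢ s ⇒* t = Star (R ⊢_⇒_) s t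

_∈R*[_]_ : Term ℕ → TRS → List (Term ℕ) → Set
p ∈R*[ R ] L = ∃[ q ] (q ∈ L × R ⊢ q ⇒* p)

-- Bottom-up tree automata.  States are Fin k; they are treated as
-- constants by working with terms over leaves ℕ ⊎ Fin k
-- (inj₁ x = variable x, inj₂ a = state a).

record BTA : Set where
  field
    k      : ℕ
    final  : List (Fin k)
    trans  : List (Σ[ f ∈ Sym ] (Vec (Fin k) (rank f) × Fin k))  -- δ(a₁,…,aₙ) → a
    eps    : List (Fin k × Fin k)                                  -- a → a'
open BTA public

BTAOver : RankedAlphabet → BTA → Set
BTAOver Σ' C = All (λ r → Data.Product.proj₁ r ∈ Σ') (trans C)

StTerm : BTA → Set
StTerm C = Term (ℕ ⊎ Fin (k C))

stateVec : ∀ {C : BTA} {n} → Vec (Fin (k C)) n → Vec (StTerm C) n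
stateVec {C} []       = []
stateVec {C} (a ∷ as) = var (inj₂ a) ∷ stateVec {C} as

data _⊢ᴬ_⇒_ (C : BTA) : StTerm C → StTerm C → Set where
  δ-step : ∀ {f as a} → (f Data.Product., (as Data.Product., a)) ∈ trans C →
           C ⊢ᴬ node f (stateVec {C} as) ⇒ var (inj₂ a)
  ε-step : ∀ {a a'} → (a Data.Product., a') ∈ eps C →
           C ⊢ᴬ var (inj₂ a) ⇒ var (inj₂ a')
  cong   : ∀ {f} (ts : Vec (StTerm C) (rank f)) (i : Fin (rank f)) {t'} →
           C ⊢ᴬ lookup ts i ⇒ t' →
           C ⊢ᴬ node f ts ⇒ node f (ts [ i ]≔ t')

_∈L[_]_ : Term ℕ → RankedAlphabet → BTA → Set
t ∈L[ Σ' ] C = InTΣ Σ' t ×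
  ∃[ a ] (a ∈ final C × Star (C ⊢ᴬ_⇒_) (rename inj₁ t) (var (inj₂ a)))

EPRF : TRS → Set
EPRF R = ∀ (Σ' : RankedAlphabet) → sign R ⊆Σ Σ' →
         (L : List (Term ℕ)) → All (InTΣ Σ') L →
         Σ[ C ∈ BTA ] (BTAOver Σ' C ×
           (∀ t → (t ∈L[ Σ' ] C → t ∈R*[ R ] L) × (t ∈R*[ R ] L → t ∈L[ Σ' ] C)))

module Submission where

-- Given p and q over Σ', we freeze their variables into fresh constants
-- (symbols named N + x, with N above every name occurring in Σ' or in R),
-- obtaining ground terms p̂ and q̂ over an enlarged finite alphabet Σ''.
-- Since R is EPRF, there are bottom-up tree automata C₁, C₂ recognising
-- the descendants of p̂ and of q̂.  The theorem then follows from two facts: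
--   * emptiness of L(C₁) ∩ L(C₂) is decidable, by saturating a table of
--     pairs of states reached jointly by some ground term (kept as a
--     witness, so that a non-empty intersection yields an actual term);
--   * thawing the fresh constants back into variables commutes with
--     rewriting, because R never mentions them; hence p and q have a
--     common reduct r iff p̂ and q̂ have one, namely the frozen r.

open import Defs
open import Data.Nat using (ℕ; zero; suc; _+_; _∸_; _≤_; _<_; _≤?_; _≟_; z≤n; s≤s)
open import Data.Nat.Properties using (≤-trans; m≤m+n; <⇒≱; m+n∸m≡n; ≤-pred; <-≤-trans; n≤1+n; n≮0)
open import Data.Product using (∃-syntax; _×_; Σ; Σ-syntax; _,_; proj₁; proj₂)
open import Data.Product.Properties using (≡-dec)
open import Data.Sum using (_⊎_; inj₁; inj₂)
open import Data.Empty using (⊥-elim)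
open import Data.Fin using (Fin; zero; suc)
import Data.Fin.Properties as FinP
open import Function using (_∘_)
open import Data.List using (List; []; _∷_; _++_; allFin; cartesianProduct; length)
import Data.List as List
open import Data.List.Extrema.Nat using (max; xs≤max)
import Data.List.Properties as ListP
open import Data.List.Relation.Unary.All using (All; []; _∷_; all?)
import Data.List.Relation.Unary.All as All
open import Data.List.Relation.Unary.All.Properties using (++⁺; ++⁻ˡ; ++⁻ʳ; ¬All⇒Any¬)
open import Data.List.Relation.Unary.Any using (Any; here; there; any?)
import Data.List.Relation.Unary.Any as Any
open import Data.List.Membership.Propositional using (_∈_; find)
open import Data.List.Membership.Propositional.Properties using (∈-cartesianProduct⁺; ∈-allFin; ∈-map⁺; ∈-map⁻; ∈-++⁺ˡ; ∈-++⁺ʳ; ∈-++⁻)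
open import Data.Vec using (Vec; []; _∷_; lookup; _[_]≔_)
import Data.Vec as Vec
import Data.Vec.Properties as VecP
open import Data.Vec.Relation.Binary.Pointwise.Inductive using (Pointwise; []; _∷_)
import Data.Vec.Relation.Binary.Pointwise.Inductive as Pointwise
open import Relation.Binary.PropositionalEquality as ≡ using (_≡_; refl; sym; subst₂; cong₂; module ≡-Reasoning)
open import Relation.Binary.Construct.Closure.ReflexiveTransitive using (Star; ε; _◅_; _◅◅_; gmap)
open import Relation.Nullary using (Dec; yes; no; ¬_)
open import Relation.Nullary.Decidable using (_×-dec_; _→-dec_; ¬?; map′)
open import Relation.Unary using (Decidable)

substV-map : ∀ {V W n} (ts : Vec (Term V) n) (σ : V → Term W) →
             substV ts σ ≡ Vec.map (_⟪ σ ⟫) ts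
substV-map []       σ = refl
substV-map (t ∷ ts) σ = ≡.cong (t ⟪ σ ⟫ ∷_) (substV-map ts σ)

⟪⟫-∘ : ∀ {U V W} (t : Term U) (σ : U → Term V) (θ : V → Term W) →
       (t ⟪ σ ⟫) ⟪ θ ⟫ ≡ t ⟪ (λ x → σ x ⟪ θ ⟫) ⟫
substV-∘ : ∀ {U V W n} (ts : Vec (Term U) n) (σ : U → Term V) (θ : V → Term W) →
           substV (substV ts σ) θ ≡ substV ts (λ x → σ x ⟪ θ ⟫)
⟪⟫-∘ (var x)     σ θ = refl
⟪⟫-∘ (node f ts) σ θ = ≡.cong (node f) (substV-∘ ts σ θ)
substV-∘ []       σ θ = refl
substV-∘ (t ∷ ts) σ θ = cong₂ _∷_ (⟪⟫-∘ t σ θ) (substV-∘ ts σ θ)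

⟪⟫-id : ∀ {V} (t : Term V) (σ : V → Term V) → All (λ x → σ x ≡ var x) (vars t) → t ⟪ σ ⟫ ≡ t
substV-id : ∀ {V n} (ts : Vec (Term V) n) (σ : V → Term V) →
            All (λ x → σ x ≡ var x) (varsV ts) → substV ts σ ≡ ts
⟪⟫-id (var x)     σ (σx≡x ∷ []) = σx≡x
⟪⟫-id (node f ts) σ fixed       = ≡.cong (node f) (substV-id ts σ fixed)
substV-id []       σ fixed = refl
substV-id (t ∷ ts) σ fixed =
  cong₂ _∷_ (⟪⟫-id t σ (++⁻ˡ (vars t) fixed)) (substV-id ts σ (++⁻ʳ (vars t) fixed))

syms-⟪⟫ : ∀ {V W} {P : Sym → Set} (t : Term V) (σ : V → Term W) →
          All P (syms t) → (∀ x → All P (syms (σ x))) → All P (syms (t ⟪ σ ⟫))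
symsV-⟪⟫ : ∀ {V W n} {P : Sym → Set} (ts : Vec (Term V) n) (σ : V → Term W) →
           All P (symsV ts) → (∀ x → All P (syms (σ x))) → All P (symsV (substV ts σ))
syms-⟪⟫ (var x)     σ _          σ-ok = σ-ok x
syms-⟪⟫ (node f ts) σ (pf ∷ pts) σ-ok = pf ∷ symsV-⟪⟫ ts σ pts σ-ok
symsV-⟪⟫ []       σ _   σ-ok = []
symsV-⟪⟫ (t ∷ ts) σ pts σ-ok =
  ++⁺ (syms-⟪⟫ t σ (++⁻ˡ (syms t) pts) σ-ok) (symsV-⟪⟫ ts σ (++⁻ʳ (syms t) pts) σ-ok)

ground-⟪⟫ : ∀ {V W} (t : Term V) (σ : V → Term W) → (∀ x → vars (σ x) ≡ []) → vars (t ⟪ σ ⟫) ≡ []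
groundV-⟪⟫ : ∀ {V W n} (ts : Vec (Term V) n) (σ : V → Term W) →
             (∀ x → vars (σ x) ≡ []) → varsV (substV ts σ) ≡ []
ground-⟪⟫ (var x)     σ σ-ground = σ-ground x
ground-⟪⟫ (node f ts) σ σ-ground = groundV-⟪⟫ ts σ σ-ground
groundV-⟪⟫ []       σ σ-ground = refl
groundV-⟪⟫ (t ∷ ts) σ σ-ground = cong₂ _++_ (ground-⟪⟫ t σ σ-ground) (groundV-⟪⟫ ts σ σ-ground)

map-[]≔-same : ∀ {A B : Set} {n} (F : A → B) (xs : Vec A n) (i : Fin n) {x} →
               F (lookup xs i) ≡ F x → Vec.map F (xs [ i ]≔ x) ≡ Vec.map F xs
map-[]≔-same F xs i {x} same = begin
  Vec.map F (xs [ i ]≔ x)                       ≡⟨ VecP.map-[]≔ F xs i ⟩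
  Vec.map F xs [ i ]≔ F x                       ≡⟨ ≡.cong (Vec.map F xs [ i ]≔_) (sym same) ⟩
  Vec.map F xs [ i ]≔ F (lookup xs i)           ≡⟨ ≡.cong (Vec.map F xs [ i ]≔_) (sym (VecP.lookup-map i F xs)) ⟩
  Vec.map F xs [ i ]≔ lookup (Vec.map F xs) i   ≡⟨ VecP.[]≔-lookup (Vec.map F xs) i ⟩
  Vec.map F xs                                  ∎
  where open ≡-Reasoning

⇒-under : ∀ {R} (F : Term ℕ → Term ℕ) {f} (ts : Vec (Term ℕ) (rank f)) (i : Fin (rank f)) {t'} →
          R ⊢ F (lookup ts i) ⇒ F t' →
          R ⊢ node f (Vec.map F ts) ⇒ node f (Vec.map F (ts [ i ]≔ t'))
⇒-under {R} F {f} ts i {t'} step =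
  ≡.subst (λ v → R ⊢ node f (Vec.map F ts) ⇒ node f v) (sym (VecP.map-[]≔ F ts i))
    (cong (Vec.map F ts) i step')
  where
  step' : R ⊢ lookup (Vec.map F ts) i ⇒ F t'
  step' = ≡.subst (λ u → R ⊢ u ⇒ F t') (sym (VecP.lookup-map i F ts)) step

⇒-⟪⟫ : ∀ {R s t} → R ⊢ s ⇒ t → (θ : ℕ → Term ℕ) → R ⊢ (s ⟪ θ ⟫) ⇒ (t ⟪ θ ⟫)
⇒-⟪⟫ {R} (root {l} {r} σ l⟶r) θ =
  subst₂ (R ⊢_⇒_) (sym (⟪⟫-∘ l σ θ)) (sym (⟪⟫-∘ r σ θ)) (root (λ x → σ x ⟪ θ ⟫) l⟶r)
⇒-⟪⟫ {R} (cong {f} ts i {t'} step) θ =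
  subst₂ (λ u v → R ⊢ node f u ⇒ node f v) (sym (substV-map ts θ)) (sym (substV-map (ts [ i ]≔ t') θ))
    (⇒-under (_⟪ θ ⟫) ts i (⇒-⟪⟫ step θ))

⇒*-⟪⟫ : ∀ {R s t} → R ⊢ s ⇒* t → (θ : ℕ → Term ℕ) → R ⊢ (s ⟪ θ ⟫) ⇒* (t ⟪ θ ⟫)
⇒*-⟪⟫ steps θ = gmap (_⟪ θ ⟫) (λ step → ⇒-⟪⟫ step θ) steps

-- Runs of a bottom-up tree automaton

-- Acceptance is defined by rewriting with the automaton's rules; a Run
-- is the equivalent inductive description: a state is assigned to every
-- node by a δ-rule applied to the states of its arguments, followed by
-- ε-moves.  Runs are easier to combine and to analyse than move sequences.
module Runs (C : BTA) where

  State : Set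
  State = Fin (k C)

  _⟶ε_ : State → State → Set
  a ⟶ε a' = (a , a') ∈ eps C

  data Run : StTerm C → State → Set
  data RunV : ∀ {n} → Vec (StTerm C) n → Vec State n → Set

  data Run where
    at-state : ∀ {a a'} → Star _⟶ε_ a a' → Run (var (inj₂ a)) a'
    by-rule  : ∀ {f ts as a a'} → (f , as , a) ∈ trans C → RunV ts as →
               Star _⟶ε_ a a' → Run (node f ts) a'

  data RunV where
    []  : RunV [] []
    _∷_ : ∀ {n t a} {ts : Vec (StTerm C) n} {as} → Run t a → RunV ts as → RunV (t ∷ ts) (a ∷ as)

  run-ε : ∀ {t a a'} → Run t a → a ⟶ε a' → Run t a'
  run-ε (at-state εs)      a⟶a' = at-state (εs ◅◅ (a⟶a' ◅ ε))
  run-ε (by-rule δ runs εs) a⟶a' = by-rule δ runs (εs ◅◅ (a⟶a' ◅ ε))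

  states-run : ∀ {n} (as : Vec State n) → RunV (stateVec {C} as) as
  states-run []       = []
  states-run (a ∷ as) = at-state ε ∷ states-run as

  runV-update : ∀ {n} (ts : Vec (StTerm C) n) (i : Fin n) {t' as} → RunV (ts [ i ]≔ t') as →
                (∀ {b} → Run t' b → Run (lookup ts i) b) → RunV ts as
  runV-update (t ∷ ts) zero    (run ∷ runs) back = back run ∷ runs
  runV-update (t ∷ ts) (suc i) (run ∷ runs) back = run ∷ runV-update ts i runs back

  run-backward : ∀ {s s' a} → C ⊢ᴬ s ⇒ s' → Run s' a → Run s a
  run-backward (δ-step δ)       (at-state εs)        = by-rule δ (states-run _) εs
  run-backward (ε-step a⟶a')    (at-state εs)        = at-state (a⟶a' ◅ εs)
  run-backward (cong ts i move) (by-rule δ runs εs) = by-rule δ (runV-update ts i runs (run-backward move)) εs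

  moves→run : ∀ {s a} → Star (C ⊢ᴬ_⇒_) s (var (inj₂ a)) → Run s a
  moves→run ε             = at-state ε
  moves→run (move ◅ moves) = run-backward move (moves→run moves)

  ArgMove : ∀ {n} → Vec (StTerm C) n → Vec (StTerm C) n → Set
  ArgMove {n} ts us = Σ[ i ∈ Fin n ] Σ[ t' ∈ StTerm C ] (C ⊢ᴬ lookup ts i ⇒ t' × us ≡ ts [ i ]≔ t')

  moves-in-args : ∀ {f} {ts us : Vec (StTerm C) (rank f)} → Star ArgMove ts us →
                  Star (C ⊢ᴬ_⇒_) (node f ts) (node f us)
  moves-in-args {f} = gmap (node f) λ { {ts} (i , _ , move , refl) → cong ts i move }

  moves-in-head : ∀ {n t u} {ts : Vec (StTerm C) n} → Star (C ⊢ᴬ_⇒_) t u → Star ArgMove (t ∷ ts) (u ∷ ts)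
  moves-in-head {ts = ts} = gmap (_∷ ts) (λ move → zero , _ , move , refl)

  moves-in-tail : ∀ {n u} {ts us : Vec (StTerm C) n} → Star ArgMove ts us → Star ArgMove (u ∷ ts) (u ∷ us)
  moves-in-tail {u = u} = gmap (u ∷_) λ { (i , t' , move , eq) → suc i , t' , move , ≡.cong (u ∷_) eq }

  ε-moves : ∀ {a a'} → Star _⟶ε_ a a' → Star (C ⊢ᴬ_⇒_) (var (inj₂ a)) (var (inj₂ a'))
  ε-moves = gmap (λ a → var (inj₂ a)) ε-step

  run→moves : ∀ {s a} → Run s a → Star (C ⊢ᴬ_⇒_) s (var (inj₂ a))
  runV→moves : ∀ {n} {ts : Vec (StTerm C) n} {as} → RunV ts as → Star ArgMove ts (stateVec {C} as)
  run→moves (at-state εs)      = ε-moves εs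
  run→moves (by-rule δ runs εs) = moves-in-args (runV→moves runs) ◅◅ (δ-step δ ◅ ε-moves εs)
  runV→moves []           = ε
  runV→moves (run ∷ runs) = moves-in-head (run→moves run) ◅◅ moves-in-tail (runV→moves runs)

module _ {A : Set} where

  count : {P : A → Set} → Decidable P → List A → ℕ
  count P? []       = 0
  count P? (x ∷ xs) with P? x
  ... | yes _ = suc (count P? xs)
  ... | no  _ = count P? xs

  count≤length : {P : A → Set} (P? : Decidable P) (xs : List A) → count P? xs ≤ length xs
  count≤length P? []       = z≤n
  count≤length P? (x ∷ xs) with P? x
  ... | yes _ = s≤s (count≤length P? xs)
  ... | no  _ = ≤-trans (count≤length P? xs) (n≤1+n _)

  count-mono : {P Q : A → Set} (P? : Decidable P) (Q? : Decidable Q) →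
               (∀ x → Q x → P x) → (xs : List A) → count Q? xs ≤ count P? xs
  count-mono P? Q? Q⇒P []       = z≤n
  count-mono P? Q? Q⇒P (x ∷ xs) with P? x | Q? x
  ... | yes _ | yes _  = s≤s (count-mono P? Q? Q⇒P xs)
  ... | yes _ | no  _  = ≤-trans (count-mono P? Q? Q⇒P xs) (n≤1+n _)
  ... | no ¬p | yes qx = ⊥-elim (¬p (Q⇒P x qx))
  ... | no  _ | no  _  = count-mono P? Q? Q⇒P xs

  count-< : {P Q : A → Set} (P? : Decidable P) (Q? : Decidable Q) →
            (∀ x → Q x → P x) → ∀ {y} (xs : List A) → y ∈ xs → P y → ¬ Q y →
            count Q? xs < count P? xs
  count-< P? Q? Q⇒P (x ∷ xs) (here refl) py ¬qy with P? x | Q? x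
  ... | yes _ | yes qx = ⊥-elim (¬qy qx)
  ... | yes _ | no  _  = s≤s (count-mono P? Q? Q⇒P xs)
  ... | no ¬p | _      = ⊥-elim (¬p py)
  count-< P? Q? Q⇒P (x ∷ xs) (there y∈xs) py ¬qy with P? x | Q? x
  ... | yes _ | yes _  = s≤s (count-< P? Q? Q⇒P xs y∈xs py ¬qy)
  ... | yes _ | no  _  = ≤-trans (count-< P? Q? Q⇒P xs y∈xs py ¬qy) (n≤1+n _)
  ... | no ¬p | yes qx = ⊥-elim (¬p (Q⇒P x qx))
  ... | no  _ | no  _  = count-< P? Q? Q⇒P xs y∈xs py ¬qy

  all-or-counterexample : {P : A → Set} → Decidable P → (xs : List A) →
                          All P xs ⊎ ∃[ x ] (x ∈ xs × ¬ P x)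
  all-or-counterexample P? xs with all? P? xs
  ... | yes all = inj₁ all
  ... | no ¬all = inj₂ (find (¬All⇒Any¬ P? xs ¬all))

refute-→ : ∀ {A B : Set} → Dec A → ¬ (A → B) → A × ¬ B
refute-→ (yes a) ¬a→b = a , λ b → ¬a→b (λ _ → b)
refute-→ (no ¬a) ¬a→b = ⊥-elim (¬a→b (λ a → ⊥-elim (¬a a)))

-- Deciding whether two bta accept a common ground term over Δ

_≟ˢ_ : (f g : Sym) → Dec (f ≡ g)
_≟ˢ_ = ≡-dec _≟_ _≟_

module Intersection (Δ : RankedAlphabet) (C₁ C₂ : BTA) where
  module R₁ = Runs C₁
  module R₂ = Runs C₂

  Pair : Set
  Pair = R₁.State × R₂.State

  _≟ᴾ_ : (x y : Pair) → Dec (x ≡ y)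
  _≟ᴾ_ = ≡-dec FinP._≟_ FinP._≟_

  Witness : Pair → Set
  Witness (a , b) = Σ[ t ∈ Term ℕ ] (InTΣ Δ t × R₁.Run (rename inj₁ t) a × R₂.Run (rename inj₁ t) b)

  WitnessV : ∀ {n} → Vec R₁.State n → Vec R₂.State n → Set
  WitnessV {n} as bs = Σ[ ts ∈ Vec (Term ℕ) n ]
    (symsV ts ⊆Σ Δ × varsV ts ≡ [] ×
     R₁.RunV (substV ts (var ∘ inj₁)) as × R₂.RunV (substV ts (var ∘ inj₁)) bs)

  Table : Set
  Table = List (Σ Pair Witness)

  _∈ᵀ_ : Pair → Table → Set
  ab ∈ᵀ S = Any (λ e → proj₁ e ≡ ab) S

  _∈ᵀ?_ : (ab : Pair) (S : Table) → Dec (ab ∈ᵀ S)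
  ab ∈ᵀ? S = any? (λ e → proj₁ e ≟ᴾ ab) S

  witness : ∀ {S ab} → ab ∈ᵀ S → Witness ab
  witness (here {x = _ , w} refl) = w
  witness (there ab∈S)            = witness ab∈S

  _,_∈ᵀ*_ : ∀ {m n} → Vec R₁.State m → Vec R₂.State n → Table → Set
  as , bs ∈ᵀ* S = Pointwise (λ a b → (a , b) ∈ᵀ S) as bs

  witnessV : ∀ {S n} {as : Vec R₁.State n} {bs : Vec R₂.State n} → as , bs ∈ᵀ* S → WitnessV as bs
  witnessV []              = [] , [] , refl , R₁.[] , R₂.[]
  witnessV (ab∈S ∷ ab∈S*) =
    let t , (t-syms , t-ground) , run₁ , run₂ = witness ab∈S
        ts , ts-syms , ts-ground , runs₁ , runs₂ = witnessV ab∈S*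
    in t ∷ ts , ++⁺ t-syms ts-syms , cong₂ _++_ t-ground ts-ground , run₁ R₁.∷ runs₁ , run₂ R₂.∷ runs₂

  Trans₁ Trans₂ : Set
  Trans₁ = Σ[ f ∈ Sym ] (Vec R₁.State (rank f) × R₁.State)
  Trans₂ = Σ[ f ∈ Sym ] (Vec R₂.State (rank f) × R₂.State)

  Joint : Table → Trans₁ → Trans₂ → Set
  Joint S (f , as , _) (g , bs , _) = f ≡ g × f ∈ Δ × as , bs ∈ᵀ* S

  Joint? : ∀ S r₁ r₂ → Dec (Joint S r₁ r₂)
  Joint? S (f , as , _) (g , bs , _) =
    f ≟ˢ g ×-dec Any.any? (f ≟ˢ_) Δ ×-dec Pointwise.decidable (λ a b → (a , b) ∈ᵀ? S) as bs

  target : ∀ {K : Set} {S : Sym → Set} → Σ Sym (λ f → S f × K) → K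
  target = proj₂ ∘ proj₂

  witness-ε₁ : ∀ {a a' b} → a R₁.⟶ε a' → Witness (a , b) → Witness (a' , b)
  witness-ε₁ a⟶a' (t , t-ground , run₁ , run₂) = t , t-ground , R₁.run-ε run₁ a⟶a' , run₂

  witness-ε₂ : ∀ {a b b'} → b R₂.⟶ε b' → Witness (a , b) → Witness (a , b')
  witness-ε₂ b⟶b' (t , t-ground , run₁ , run₂) = t , t-ground , run₁ , R₂.run-ε run₂ b⟶b'

  witness-δ : ∀ {S} r₁ r₂ → r₁ ∈ trans C₁ → r₂ ∈ trans C₂ → Joint S r₁ r₂ →
              Witness (target r₁ , target r₂)
  witness-δ (f , as , a) (.f , bs , b) δ₁ δ₂ (refl , f∈Δ , args) =
    let ts , ts-syms , ts-ground , runs₁ , runs₂ = witnessV args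
    in node f ts , (f∈Δ ∷ ts-syms , ts-ground) , R₁.by-rule δ₁ runs₁ ε , R₂.by-rule δ₂ runs₂ ε

  ε₁-Closed : Table → R₁.State × R₁.State → Set
  ε₁-Closed S (a , a') = ∀ b → (a , b) ∈ᵀ S → (a' , b) ∈ᵀ S

  ε₂-Closed : Table → R₂.State × R₂.State → Set
  ε₂-Closed S (b , b') = ∀ a → (a , b) ∈ᵀ S → (a , b') ∈ᵀ S

  δ-Closed : Table → Trans₁ → Trans₂ → Set
  δ-Closed S r₁ r₂ = Joint S r₁ r₂ → (target r₁ , target r₂) ∈ᵀ S

  record Closed (S : Table) : Set where
    field
      ε₁-closed : All (ε₁-Closed S) (eps C₁)
      ε₂-closed : All (ε₂-Closed S) (eps C₂)
      δ-closed  : All (λ r₁ → All (δ-Closed S r₁) (trans C₂)) (trans C₁)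

  Extension : Table → Set
  Extension S = Σ[ e ∈ Σ Pair Witness ] ¬ (proj₁ e ∈ᵀ S)

  ε₁-at? : ∀ S a a' b → Dec ((a , b) ∈ᵀ S → (a' , b) ∈ᵀ S)
  ε₁-at? S a a' b = (a , b) ∈ᵀ? S →-dec (a' , b) ∈ᵀ? S

  ε₂-at? : ∀ S b b' a → Dec ((a , b) ∈ᵀ S → (a , b') ∈ᵀ S)
  ε₂-at? S b b' a = (a , b) ∈ᵀ? S →-dec (a , b') ∈ᵀ? S

  ε₁-Closed? : ∀ S e → Dec (ε₁-Closed S e)
  ε₁-Closed? S (a , a') = FinP.all? (ε₁-at? S a a')

  ε₂-Closed? : ∀ S e → Dec (ε₂-Closed S e)
  ε₂-Closed? S (b , b') = FinP.all? (ε₂-at? S b b')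

  δ-Closed? : ∀ S r₁ r₂ → Dec (δ-Closed S r₁ r₂)
  δ-Closed? S r₁ r₂ = Joint? S r₁ r₂ →-dec (target r₁ , target r₂) ∈ᵀ? S

  ε₁-extend : ∀ S → Extension S ⊎ All (ε₁-Closed S) (eps C₁)
  ε₁-extend S with all-or-counterexample (ε₁-Closed? S) (eps C₁)
  ... | inj₁ closed = inj₂ closed
  ... | inj₂ ((a , a') , a⟶a' , not-closed) =
    let b , gap = FinP.¬∀⟶∃¬ _ _ (ε₁-at? S a a') not-closed
        ab∈S , a'b∉S = refute-→ ((a , b) ∈ᵀ? S) gap
    in inj₁ ((_ , witness-ε₁ a⟶a' (witness ab∈S)) , a'b∉S)

  ε₂-extend : ∀ S → Extension S ⊎ All (ε₂-Closed S) (eps C₂)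
  ε₂-extend S with all-or-counterexample (ε₂-Closed? S) (eps C₂)
  ... | inj₁ closed = inj₂ closed
  ... | inj₂ ((b , b') , b⟶b' , not-closed) =
    let a , gap = FinP.¬∀⟶∃¬ _ _ (ε₂-at? S b b') not-closed
        ab∈S , ab'∉S = refute-→ ((a , b) ∈ᵀ? S) gap
    in inj₁ ((_ , witness-ε₂ b⟶b' (witness ab∈S)) , ab'∉S)

  δ-extend : ∀ S → Extension S ⊎ All (λ r₁ → All (δ-Closed S r₁) (trans C₂)) (trans C₁)
  δ-extend S with all-or-counterexample (λ r₁ → all? (δ-Closed? S r₁) (trans C₂)) (trans C₁)
  ... | inj₁ closed = inj₂ closed
  ... | inj₂ (r₁ , δ₁ , not-closed) =
    let r₂ , δ₂ , gap = find (¬All⇒Any¬ (δ-Closed? S r₁) (trans C₂) not-closed)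
        joint , ∉S = refute-→ (Joint? S r₁ r₂) gap
    in inj₁ ((_ , witness-δ r₁ r₂ δ₁ δ₂ joint) , ∉S)

  extend-or-closed : ∀ S → Extension S ⊎ Closed S
  extend-or-closed S with ε₁-extend S | ε₂-extend S | δ-extend S
  ... | inj₁ ext | _        | _        = inj₁ ext
  ... | _        | inj₁ ext | _        = inj₁ ext
  ... | _        | _        | inj₁ ext = inj₁ ext
  ... | inj₂ c₁  | inj₂ c₂  | inj₂ c₃  = inj₂ record { ε₁-closed = c₁ ; ε₂-closed = c₂ ; δ-closed = c₃ }

  -- Saturation terminates: each extension decreases the number of pairs
  -- missing from the table.
  allPairs : List Pair
  allPairs = cartesianProduct (allFin (k C₁)) (allFin (k C₂))

  missing : Table → ℕ
  missing S = count (λ ab → ¬? (ab ∈ᵀ? S)) allPairs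

  extension-shrinks : ∀ {S} (ext : Extension S) → missing (proj₁ ext ∷ S) < missing S
  extension-shrinks {S} (e@((a , b) , _) , new) =
    count-< (λ ab → ¬? (ab ∈ᵀ? S)) (λ ab → ¬? (ab ∈ᵀ? (e ∷ S))) (λ _ ∉e∷S ∈S → ∉e∷S (there ∈S))
      allPairs (∈-cartesianProduct⁺ (∈-allFin a) (∈-allFin b)) new (λ ∉e∷S → ∉e∷S (here refl))

  saturate : (fuel : ℕ) (S : Table) → missing S ≤ fuel → Σ Table Closed
  saturate fuel S bound with extend-or-closed S
  ... | inj₂ closed = S , closed
  saturate zero    S bound | inj₁ ext = ⊥-elim (n≮0 (<-≤-trans (extension-shrinks ext) bound))
  saturate (suc n) S bound | inj₁ ext =
    saturate n (proj₁ ext ∷ S) (≤-pred (<-≤-trans (extension-shrinks ext) bound))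

  saturation : Σ Table Closed
  saturation = saturate (length allPairs) [] (count≤length _ allPairs)

  module Complete {S : Table} (closed : Closed S) where
    open Closed closed

    ε₁*-closed : ∀ {a a' b} → (a , b) ∈ᵀ S → Star R₁._⟶ε_ a a' → (a' , b) ∈ᵀ S
    ε₁*-closed ab∈S ε               = ab∈S
    ε₁*-closed ab∈S (a⟶a' ◅ a'⟶*a'') = ε₁*-closed (All.lookup ε₁-closed a⟶a' _ ab∈S) a'⟶*a''

    ε₂*-closed : ∀ {a b b'} → (a , b) ∈ᵀ S → Star R₂._⟶ε_ b b' → (a , b') ∈ᵀ S
    ε₂*-closed ab∈S ε               = ab∈S
    ε₂*-closed ab∈S (b⟶b' ◅ b'⟶*b'') = ε₂*-closed (All.lookup ε₂-closed b⟶b' _ ab∈S) b'⟶*b''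

    reached : ∀ t → InTΣ Δ t → ∀ {a b} → R₁.Run (rename inj₁ t) a → R₂.Run (rename inj₁ t) b → (a , b) ∈ᵀ S
    reachedV : ∀ {n} (ts : Vec (Term ℕ) n) → symsV ts ⊆Σ Δ → varsV ts ≡ [] → ∀ {as bs} →
               R₁.RunV (substV ts (var ∘ inj₁)) as → R₂.RunV (substV ts (var ∘ inj₁)) bs → as , bs ∈ᵀ* S
    reached (var x) (_ , ())
    reached (node f ts) (f∈Δ ∷ ts-syms , ts-ground)
            (R₁.by-rule {as = as} {a = a} δ₁ runs₁ εs₁) (R₂.by-rule {as = bs} {a = b} δ₂ runs₂ εs₂) =
      ε₂*-closed (ε₁*-closed (All.lookup (All.lookup δ-closed δ₁) δ₂ joint) εs₁) εs₂
      where
      joint : Joint S (f , as , a) (f , bs , b)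
      joint = refl , f∈Δ , reachedV ts ts-syms ts-ground runs₁ runs₂
    reachedV []       _ _ R₁.[] R₂.[] = []
    reachedV (t ∷ ts) syms-ok ground (run₁ R₁.∷ runs₁) (run₂ R₂.∷ runs₂) =
      reached t (++⁻ˡ (syms t) syms-ok , ListP.++-conicalˡ (vars t) _ ground) run₁ run₂ ∷
      reachedV ts (++⁻ʳ (syms t) syms-ok) (ListP.++-conicalʳ (vars t) _ ground) runs₁ runs₂

  decide-intersection : Dec (∃[ t ] (t ∈L[ Δ ] C₁ × t ∈L[ Δ ] C₂))
  decide-intersection = map′ from-entry to-entry (any? (λ e → final? (proj₁ e)) S)
    where
    S : Table
    S = proj₁ saturation

    Final : Pair → Set
    Final (a , b) = a ∈ final C₁ × b ∈ final C₂

    final? : ∀ ab → Dec (Final ab)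
    final? (a , b) = any? (a FinP.≟_) (final C₁) ×-dec any? (b FinP.≟_) (final C₂)

    from-entry : Any (Final ∘ proj₁) S → ∃[ t ] (t ∈L[ Δ ] C₁ × t ∈L[ Δ ] C₂)
    from-entry final-entry with Any.satisfied final-entry
    ... | ((a , b) , t , t-ground , run₁ , run₂) , a-final , b-final =
      t , (t-ground , a , a-final , R₁.run→moves run₁) , (t-ground , b , b-final , R₂.run→moves run₂)

    to-entry : ∃[ t ] (t ∈L[ Δ ] C₁ × t ∈L[ Δ ] C₂) → Any (Final ∘ proj₁) S
    to-entry (t , (t-ground , a , a-final , moves₁) , (_ , b , b-final , moves₂)) =
      Any.map (λ { refl → a-final , b-final })
        (Complete.reached (proj₂ saturation) t t-ground (R₁.moves→run moves₁) (R₂.moves→run moves₂))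

-- Freezing variables into fresh constants, and thawing them back

-- Symbols named N or more are reserved: the constant named N + x stands
-- for the variable x.  Thawing turns every reserved symbol back into a
-- variable; it commutes with rewriting by a TRS using no reserved symbol.
module Freezing (N : ℕ) where

  Unreserved : ∀ {V} → Term V → Set
  Unreserved t = All (λ f → proj₁ f < N) (syms t)

  frozen : ℕ → Term ℕ
  frozen x = node (N + x , 0) []

  thaw : Term ℕ → Term ℕ
  thawV : ∀ {n} → Vec (Term ℕ) n → Vec (Term ℕ) n
  thaw (var x) = var x
  thaw (node f ts) with N ≤? proj₁ f
  ... | yes _ = var (proj₁ f ∸ N)
  ... | no  _ = node f (thawV ts)
  thawV []       = []
  thawV (t ∷ ts) = thaw t ∷ thawV ts

  -- thawV is thaw on each argument (it is defined separately only for termination).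
  thawV-map : ∀ {n} (ts : Vec (Term ℕ) n) → thawV ts ≡ Vec.map thaw ts
  thawV-map []       = refl
  thawV-map (t ∷ ts) = ≡.cong (thaw t ∷_) (thawV-map ts)

  thaw-frozen : ∀ x → thaw (frozen x) ≡ var x
  thaw-frozen x with N ≤? N + x
  ... | yes _   = ≡.cong var (m+n∸m≡n N x)
  ... | no N≰N+x = ⊥-elim (N≰N+x (m≤m+n N x))

  thaw-⟪⟫ : (l : Term ℕ) (σ : ℕ → Term ℕ) → Unreserved l → thaw (l ⟪ σ ⟫) ≡ l ⟪ thaw ∘ σ ⟫
  thawV-⟪⟫ : ∀ {n} (ls : Vec (Term ℕ) n) (σ : ℕ → Term ℕ) → All (λ f → proj₁ f < N) (symsV ls) →
             thawV (substV ls σ) ≡ substV ls (thaw ∘ σ)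
  thaw-⟪⟫ (var x)     σ _ = refl
  thaw-⟪⟫ (node f ts) σ (f<N ∷ ts<N) with N ≤? proj₁ f
  ... | yes N≤f = ⊥-elim (<⇒≱ f<N N≤f)
  ... | no  _   = ≡.cong (node f) (thawV-⟪⟫ ts σ ts<N)
  thawV-⟪⟫ []       σ _   = refl
  thawV-⟪⟫ (t ∷ ts) σ ts<N =
    cong₂ _∷_ (thaw-⟪⟫ t σ (++⁻ˡ (syms t) ts<N)) (thawV-⟪⟫ ts σ (++⁻ʳ (syms t) ts<N))

  thaw-syms : ∀ {Σ'} t → All (λ f → f ∈ Σ' ⊎ N ≤ proj₁ f) (syms t) → InTΣX Σ' (thaw t)
  thawV-syms : ∀ {Σ' n} (ts : Vec (Term ℕ) n) → All (λ f → f ∈ Σ' ⊎ N ≤ proj₁ f) (symsV ts) →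
               symsV (thawV ts) ⊆Σ Σ'
  thaw-syms (var x) _ = []
  thaw-syms (node f ts) (f-ok ∷ ts-ok) with N ≤? proj₁ f | f-ok
  ... | yes _    | _         = []
  ... | no  _    | inj₁ f∈Σ' = f∈Σ' ∷ thawV-syms ts ts-ok
  ... | no  N≰f  | inj₂ N≤f  = ⊥-elim (N≰f N≤f)
  thawV-syms []       _     = []
  thawV-syms (t ∷ ts) ts-ok = ++⁺ (thaw-syms t (++⁻ˡ (syms t) ts-ok)) (thawV-syms ts (++⁻ʳ (syms t) ts-ok))

  module _ (R : TRS) (R-unreserved : All (λ ρ → Unreserved (Rule.lhs ρ) × Unreserved (Rule.rhs ρ)) (rules R)) where

    thaw-⇒ : ∀ {s t} → R ⊢ s ⇒ t → (thaw s ≡ thaw t) ⊎ (R ⊢ thaw s ⇒ thaw t)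
    thaw-⇒ (root {l} {r} σ l⟶r) =
      let l-unreserved , r-unreserved = All.lookup R-unreserved l⟶r
      in inj₂ (subst₂ (R ⊢_⇒_) (sym (thaw-⟪⟫ l σ l-unreserved)) (sym (thaw-⟪⟫ r σ r-unreserved))
                 (root (thaw ∘ σ) l⟶r))
    thaw-⇒ (cong {f} ts i {t'} step) with N ≤? proj₁ f | thaw-⇒ step
    ... | yes _ | _         = inj₁ refl
    ... | no  _ | inj₁ same = inj₁ (≡.cong (node f) (begin
      thawV ts                    ≡⟨ thawV-map ts ⟩
      Vec.map thaw ts             ≡⟨ sym (map-[]≔-same thaw ts i same) ⟩
      Vec.map thaw (ts [ i ]≔ t') ≡⟨ sym (thawV-map (ts [ i ]≔ t')) ⟩
      thawV (ts [ i ]≔ t')        ∎))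
      where open ≡-Reasoning
    ... | no  _ | inj₂ step' = inj₂ (subst₂ (λ u v → R ⊢ node f u ⇒ node f v)
                                      (sym (thawV-map ts)) (sym (thawV-map (ts [ i ]≔ t')))
                                      (⇒-under thaw ts i step'))

    thaw-⇒* : ∀ {s t} → R ⊢ s ⇒* t → R ⊢ thaw s ⇒* thaw t
    thaw-⇒* ε = ε
    thaw-⇒* (step ◅ steps) with thaw-⇒ step
    ... | inj₁ same  = ≡.subst (λ u → R ⊢ u ⇒* _) (sym same) (thaw-⇒* steps)
    ... | inj₂ step' = step' ◅ thaw-⇒* steps

nameBound : List Sym → ℕ
nameBound S = max 0 (List.map proj₁ S)

name≤bound : ∀ {f S} → f ∈ S → proj₁ f ≤ nameBound S
name≤bound {S = S} f∈S = All.lookup (xs≤max 0 (List.map proj₁ S)) (∈-map⁺ proj₁ f∈S)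

ruleSyms : List Rule → List Sym
ruleSyms []       = []
ruleSyms (ρ ∷ ρs) = (syms (Rule.lhs ρ) ++ syms (Rule.rhs ρ)) ++ ruleSyms ρs

rule-syms : ∀ {ρ ρs} → ρ ∈ ρs → (syms (Rule.lhs ρ) ++ syms (Rule.rhs ρ)) ⊆Σ ruleSyms ρs
rule-syms (here refl) = All.tabulate ∈-++⁺ˡ
rule-syms {ρs = ρ' ∷ _} (there ρ∈ρs) = All.map (∈-++⁺ʳ (syms (Rule.lhs ρ') ++ syms (Rule.rhs ρ'))) (rule-syms ρ∈ρs)

module Joinability (R : TRS) (eprf : EPRF R) (Σ' : RankedAlphabet) (sign⊆Σ' : sign R ⊆Σ Σ')
                   (p q : Term ℕ) (pΣ' : InTΣX Σ' p) (qΣ' : InTΣX Σ' q) where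

  -- Names from N on are fresh for Σ' and for R.
  N : ℕ
  N = suc (nameBound (Σ' ++ ruleSyms (rules R)))

  open Freezing N

  below-N : ∀ {f} → f ∈ Σ' ++ ruleSyms (rules R) → proj₁ f < N
  below-N f∈ = s≤s (name≤bound f∈)

  R-unreserved : All (λ ρ → Unreserved (Rule.lhs ρ) × Unreserved (Rule.rhs ρ)) (rules R)
  R-unreserved = All.tabulate λ {ρ} ρ∈R →
    let ρ-below = All.map (below-N ∘ ∈-++⁺ʳ Σ') (rule-syms ρ∈R)
    in ++⁻ˡ (syms (Rule.lhs ρ)) ρ-below , ++⁻ʳ (syms (Rule.lhs ρ)) ρ-below

  -- Variables of p and q are frozen to their own constants; all others
  -- to the constant for 0, so that frozen terms stay over a finite alphabet.
  V : List ℕ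
  V = vars p ++ vars q

  clamp : ℕ → ℕ
  clamp x with any? (x ≟_) V
  ... | yes _ = x
  ... | no  _ = 0

  clamp-in : ∀ x → clamp x ∈ 0 ∷ V
  clamp-in x with any? (x ≟_) V
  ... | yes x∈V = there x∈V
  ... | no  _   = here refl

  clamp-id : ∀ {x} → x ∈ V → clamp x ≡ x
  clamp-id {x} x∈V with any? (x ≟_) V
  ... | yes _   = refl
  ... | no  x∉V = ⊥-elim (x∉V x∈V)

  freeze : Term ℕ → Term ℕ
  freeze t = t ⟪ frozen ∘ clamp ⟫

  Σ'' : RankedAlphabet
  Σ'' = Σ' ++ List.map (λ x → (N + x , 0)) (0 ∷ V)

  freeze-ground : ∀ t → InTΣX Σ' t → InTΣ Σ'' (freeze t)
  freeze-ground t tΣ' =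
    syms-⟪⟫ t _ (All.map ∈-++⁺ˡ tΣ') (λ x → ∈-++⁺ʳ Σ' (∈-map⁺ _ (clamp-in x)) ∷ []) ,
    ground-⟪⟫ t _ (λ _ → refl)

  thaw-freeze : ∀ t → InTΣX Σ' t → All (_∈ V) (vars t) → thaw (freeze t) ≡ t
  thaw-freeze t tΣ' t-vars = ≡.trans (thaw-⟪⟫ t _ (All.map (below-N ∘ ∈-++⁺ˡ) tΣ'))
    (⟪⟫-id t _ (All.map (λ x∈V → ≡.trans (thaw-frozen _) (≡.cong var (clamp-id x∈V))) t-vars))

  thaw-Σ'' : ∀ t → InTΣ Σ'' t → InTΣX Σ' (thaw t)
  thaw-Σ'' t (t-syms , _) = thaw-syms t (All.map fresh-or-in-Σ' t-syms)
    where
    fresh-or-in-Σ' : ∀ {f} → f ∈ Σ'' → f ∈ Σ' ⊎ N ≤ proj₁ f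
    fresh-or-in-Σ' f∈Σ'' with ∈-++⁻ Σ' f∈Σ''
    ... | inj₁ f∈Σ' = inj₁ f∈Σ'
    ... | inj₂ f-fresh with ∈-map⁻ _ f-fresh
    ...   | x , _ , refl = inj₂ (m≤m+n N x)

  thaw-descendant : ∀ s {t} → InTΣX Σ' s → All (_∈ V) (vars s) → R ⊢ freeze s ⇒* t → R ⊢ s ⇒* thaw t
  thaw-descendant s sΣ' s-vars steps =
    ≡.subst (λ u → R ⊢ u ⇒* _) (thaw-freeze s sΣ' s-vars) (thaw-⇒* R R-unreserved steps)

  record DescendantAutomaton (s : Term ℕ) : Set where
    field
      automaton : BTA
      sound     : ∀ {u} → u ∈L[ Σ'' ] automaton → R ⊢ s ⇒* u
      complete  : ∀ {u} → R ⊢ s ⇒* u → u ∈L[ Σ'' ] automaton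

  from-singleton : ∀ {s u} → u ∈R*[ R ] (s ∷ []) → R ⊢ s ⇒* u
  from-singleton (_ , here refl , steps) = steps

  descendants : ∀ t → InTΣX Σ' t → DescendantAutomaton (freeze t)
  descendants t tΣ' with eprf Σ'' (All.map ∈-++⁺ˡ sign⊆Σ') (freeze t ∷ []) (freeze-ground t tΣ' ∷ [])
  ... | C , _ , correct = record
    { automaton = C
    ; sound     = λ {u} u∈L → from-singleton (proj₁ (correct u) u∈L)
    ; complete  = λ {u} steps → proj₂ (correct u) (freeze t , here refl , steps)
    }

  module D₁ = DescendantAutomaton (descendants p pΣ')
  module D₂ = DescendantAutomaton (descendants q qΣ')

  Joinable : Set
  Joinable = ∃[ r ] (InTΣX Σ' r × R ⊢ p ⇒* r × R ⊢ q ⇒* r)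

  CommonDescendant : Set
  CommonDescendant = ∃[ t ] (t ∈L[ Σ'' ] D₁.automaton × t ∈L[ Σ'' ] D₂.automaton)

  thaw-common : CommonDescendant → Joinable
  thaw-common (t , t∈L₁ , t∈L₂) =
    thaw t , thaw-Σ'' t (proj₁ t∈L₁) ,
    thaw-descendant p pΣ' (All.tabulate ∈-++⁺ˡ) (D₁.sound t∈L₁) ,
    thaw-descendant q qΣ' (All.tabulate (∈-++⁺ʳ (vars p))) (D₂.sound t∈L₂)

  freeze-common : Joinable → CommonDescendant
  freeze-common (r , _ , p⇒*r , q⇒*r) =
    freeze r , D₁.complete (⇒*-⟪⟫ p⇒*r _) , D₂.complete (⇒*-⟪⟫ q⇒*r _)

mainTheorem3 : (R : TRS) → EPRF R → (Σ' : RankedAlphabet) → sign R ⊆Σ Σ' →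
    (p q : Term ℕ) → InTΣX Σ' p → InTΣX Σ' q →
    Dec (∃[ r ] (InTΣX Σ' r × R ⊢ p ⇒* r × R ⊢ q ⇒* r))
mainTheorem3 R eprf Σ' sign⊆Σ' p q pΣ' qΣ' =
  map′ thaw-common freeze-common (decide-intersection Σ'' D₁.automaton D₂.automaton)
  where
  open Joinability R eprf Σ' sign⊆Σ' p q pΣ' qΣ'
  open Intersection using (decide-intersection)
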